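{- Let $k,n \in \mathbb{N}$ with $k,n \geq 1$, and let $N = 2kn+1$. Let $C$ be the $N \times N$ circulant boolean matrix $C = \mathrm{circ}\{(c_1,\ldots,c_N)\}$ whose first row is $$(c_1,\ldots,c_N) = (1,\underbrace{1,\ldots,1}_{k},0,\ldots,0,\underbrace{1,\ldots,1}_{k}),$$ i.e. $c_j = \sum_{l=0}^{k} \delta_{j,1+l} + \sum_{l=0}^{k-1} \delta_{j,1+2kn-l}$ for $j=1,\ldots,N$. Then the central $(2k+1)$-nomial coefficient satisfies $$M^{(2k,n)} = \frac{1}{2kn+1}\,\mathrm{Tr}\big[C^n\big].$$
   Context: For a vector $(c_1,\ldots,c_N)$, $\mathrm{circ}\{(c_1,\ldots,c_N)\}$ denotes the $N\times N$ circulant matrix whose first row is $(c_1,\ldots,c_N)$ and each subsequent row is the previous row cyclically shifted one position to the right, i.e. its $(i,j)$ entry is $c_{((j-i) \bmod N)+1}$. For $k,n\geq 1$, write $(1+x+x^2+\cdots+x^{2k})^n = \sum_{l=0}^{2kn} p_l^{(n)} x^l$; the central $(2k+1)$-nomial coefficient is $M^{(2k,n)} = p_{kn}^{(n)}$, the coefficient of $x^{kn}$. -}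

module Defs where

open import Data.Nat using (ℕ; zero; suc; _+_; _*_; _∸_; _≤_; _≤ᵇ_; _%_)
open import Data.Bool using (Bool; true; false; if_then_else_; _∨_)
open import Data.Fin using (Fin; toℕ)
open import Data.List using (List; []; _∷_; replicate; lookup; length)
open import Data.Fin.Properties using ()

Mat : ℕ → Set
Mat N = Fin N → Fin N → ℕ

sumFin : ∀ {N} → (Fin N → ℕ) → ℕ
sumFin {zero}  f = 0
sumFin {suc N} f = f Fin.zero + sumFin (λ i → f (Fin.suc i))
  where import Data.Fin as Fin

_⊗_ : ∀ {N} → Mat N → Mat N → Mat N
(A ⊗ B) i j = sumFin (λ m → A i m * B m j)

identity : ∀ {N} → Mat N
identity i j = if toℕ i Data.Nat.≡ᵇ toℕ j then 1 else 0
  where import Data.Nat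

matPow : ∀ {N} → Mat N → ℕ → Mat N
matPow A zero    = identity
matPow A (suc n) = A ⊗ matPow A n

trace : ∀ {N} → Mat N → ℕ
trace A = sumFin (λ i → A i i)

-- circ{(c_1,…,c_N)} with c given 0-based: c m = c_{m+1}.
-- Entry (i,j) (0-based) is c_{((j-i) mod N)+1} = c ((j - i) mod N).
circ : (N : ℕ) → (ℕ → ℕ) → Mat N
circ (suc N) c i j = c (((toℕ j + suc N) ∸ toℕ i) % suc N)
circ zero    c () j

-- First row of C, 0-based:  c m = c_{m+1}, with
-- c_j = Σ_{l=0}^{k} δ_{j,1+l} + Σ_{l=0}^{k-1} δ_{j,1+2kn-l}.
firstRow : (k n : ℕ) → ℕ → ℕ
firstRow k n m = sumFin {suc k} (λ l → δ m (toℕ l)) + sumFin {k} (λ l → δ m (2 * k * n ∸ toℕ l))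
  where
  δ : ℕ → ℕ → ℕ
  δ a b = if a Data.Nat.≡ᵇ b then 1 else 0
    where import Data.Nat

Cmat : (k n : ℕ) → Mat (suc (2 * k * n))
Cmat k n = circ (suc (2 * k * n)) (firstRow k n)

-- Polynomials over ℕ as coefficient lists (constant term first).
Poly : Set
Poly = List ℕ

_+ₚ_ : Poly → Poly → Poly
[] +ₚ q = q
(a ∷ p) +ₚ [] = a ∷ p
(a ∷ p) +ₚ (b ∷ q) = (a + b) ∷ (p +ₚ q)

scale : ℕ → Poly → Poly
scale a [] = []
scale a (b ∷ q) = (a * b) ∷ scale a q

_*ₚ_ : Poly → Poly → Poly
[] *ₚ q = []
(a ∷ p) *ₚ q = scale a q +ₚ (0 ∷ (p *ₚ q))

powₚ : Poly → ℕ → Poly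
powₚ p zero = 1 ∷ []
powₚ p (suc n) = p *ₚ powₚ p n

coeff : Poly → ℕ → ℕ
coeff [] l = 0
coeff (a ∷ p) zero = a
coeff (a ∷ p) (suc l) = coeff p l

geomPoly : ℕ → Poly
geomPoly k = replicate (suc (2 * k)) 1

centralMultinomial : ℕ → ℕ → ℕ
centralMultinomial k n = coeff (powₚ (geomPoly k) n) (k * n)

module Submission where

-- Put N = 2kn + 1.  The first row c of C is the indicator of the residues
-- -k, …, k modulo N, so C is the step matrix of walks on Z/N with steps in
-- {-k, …, k}.
--
-- * Circulant algebra (module Cyclic): a product of circulant matrices is the
--   circulant of the cyclic convolution of the first rows, hence
--   C^m = circ N (rowPow c m); and the trace of circ N g is N · g 0.
-- * Counting walks (module Walks): as long as 2km < N no walk of length m wraps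
--   around, so rowPow c m r is the coefficient of x^(r + km mod N) in
--   (1 + x + ⋯ + x^{2k})^m.  This follows by induction on m from the sifting
--   property of c, Pascal's rule for these coefficients and their degree bound.
--
-- With m = n and r = 0 this gives Tr C^n = N · [x^{kn}] (1 + ⋯ + x^{2k})^n.

open import Defs
open import Data.Nat using (ℕ; _+_; _*_; _≥_; suc)
open import Relation.Binary.PropositionalEquality using (_≡_)
open import Data.Nat.Base using (zero; _≡ᵇ_; _∸_; _%_; _≤_; _<_; z<s; s<s; s≤s; s≤s⁻¹)
open import Data.Nat.Properties
open import Data.Nat.DivMod using (%-distribˡ-+; m%n%n≡m%n; [m+n]%n≡m%n; [m+kn]%n≡m%n; m%n<n; m%n≤n; m<n⇒m%n≡m; n%n≡0)
open import Data.Fin using (Fin; toℕ; fromℕ<)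
import Data.Fin as Fin
open import Data.Fin.Properties using (toℕ-fromℕ<; toℕ<n; toℕ-injective)
open import Algebra.Properties.CommutativeSemigroup +-commutativeSemigroup using (interchange)
open import Data.List using ([]; _∷_; replicate; length)
open import Data.List.Properties using (length-replicate)
open import Data.Nat.Solver using (module +-*-Solver)
open +-*-Solver using (solve; _:+_; _:*_; _:=_; con)
open import Function using (_∘_)
open import Data.Bool using (if_then_else_)
open import Data.Empty using (⊥-elim)
open import Relation.Binary.PropositionalEquality using (refl; sym; trans; cong; cong₂; _≢_; module ≡-Reasoning)
open import Relation.Nullary using (yes; no)

-- ∑ L f = f 0 + f 1 + ⋯ + f (L ∸ 1).  Defined through sumFin, so that
-- ∑ (suc L) f unfolds to f 0 + ∑ L (f ∘ suc) and traces are such sums.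
∑ : ℕ → (ℕ → ℕ) → ℕ
∑ L f = sumFin {L} (λ i → f (toℕ i))

sumFin-cong : ∀ {L} {f g : Fin L → ℕ} → (∀ i → f i ≡ g i) → sumFin f ≡ sumFin g
sumFin-cong {zero}  eq = refl
sumFin-cong {suc L} eq = cong₂ _+_ (eq Fin.zero) (sumFin-cong (eq ∘ Fin.suc))

∑-cong : ∀ L {f g : ℕ → ℕ} → (∀ j → j < L → f j ≡ g j) → ∑ L f ≡ ∑ L g
∑-cong zero    eq = refl
∑-cong (suc L) eq = cong₂ _+_ (eq 0 z<s) (∑-cong L (λ j j<L → eq (suc j) (s<s j<L)))

∑-zero : ∀ L {f : ℕ → ℕ} → (∀ j → j < L → f j ≡ 0) → ∑ L f ≡ 0
∑-zero zero    eq = refl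
∑-zero (suc L) eq = cong₂ _+_ (eq 0 z<s) (∑-zero L (λ j j<L → eq (suc j) (s<s j<L)))

∑-const : ∀ L c → ∑ L (λ _ → c) ≡ L * c
∑-const zero    c = refl
∑-const (suc L) c = cong (c +_) (∑-const L c)

∑-+ : ∀ L (f g : ℕ → ℕ) → ∑ L (λ j → f j + g j) ≡ ∑ L f + ∑ L g
∑-+ zero    f g = refl
∑-+ (suc L) f g = trans (cong (f 0 + g 0 +_) (∑-+ L (f ∘ suc) (g ∘ suc)))
                        (interchange (f 0) (g 0) _ _)

∑-*ʳ : ∀ L (f : ℕ → ℕ) x → ∑ L f * x ≡ ∑ L (λ j → f j * x)
∑-*ʳ zero    f x = refl
∑-*ʳ (suc L) f x = trans (*-distribʳ-+ x (f 0) _) (cong (f 0 * x +_) (∑-*ʳ L (f ∘ suc) x))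

∑-comm : ∀ A B (F : ℕ → ℕ → ℕ) →
         ∑ A (λ u → ∑ B (λ l → F u l)) ≡ ∑ B (λ l → ∑ A (λ u → F u l))
∑-comm zero    B F = sym (∑-zero B (λ _ _ → refl))
∑-comm (suc A) B F = trans (cong (∑ B (F 0) +_) (∑-comm A B (F ∘ suc)))
                           (sym (∑-+ B (F 0) (λ l → ∑ A (λ u → F (suc u) l))))

∑-split : ∀ a b (f : ℕ → ℕ) → ∑ (a + b) f ≡ ∑ a f + ∑ b (λ j → f (a + j))
∑-split zero    b f = refl
∑-split (suc a) b f = trans (cong (f 0 +_) (∑-split a b (f ∘ suc))) (sym (+-assoc (f 0) _ _))

∑-last : ∀ L (f : ℕ → ℕ) → ∑ (suc L) f ≡ ∑ L f + f L
∑-last zero    f = +-comm (f 0) 0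
∑-last (suc L) f = trans (cong (f 0 +_) (∑-last L (f ∘ suc))) (sym (+-assoc (f 0) _ _))

∑-reverse : ∀ L (f : ℕ → ℕ) → ∑ L f ≡ ∑ L (λ j → f (L ∸ suc j))
∑-reverse zero    f = refl
∑-reverse (suc L) f = begin
  f 0 + ∑ L (f ∘ suc)                       ≡⟨ cong (f 0 +_) (∑-reverse L (f ∘ suc)) ⟩
  f 0 + ∑ L (λ j → f (suc (L ∸ suc j)))     ≡⟨ cong (f 0 +_) (∑-cong L (λ j j<L → cong f (sym (+-∸-assoc 1 j<L)))) ⟩
  f 0 + ∑ L (λ j → f (L ∸ j))               ≡⟨ +-comm (f 0) _ ⟩
  ∑ L (λ j → f (L ∸ j)) + f 0               ≡⟨ cong (λ x → ∑ L (λ j → f (L ∸ j)) + f x) (sym (n∸n≡0 L)) ⟩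
  ∑ L (λ j → f (L ∸ j)) + f (L ∸ L)         ≡⟨ sym (∑-last L (λ j → f (L ∸ j))) ⟩
  ∑ (suc L) (λ j → f (L ∸ j))               ∎
  where open ≡-Reasoning

∑-window : ∀ k (Q : ℕ → ℕ) z →
           ∑ (suc k) (λ l → Q (z ∸ l)) + ∑ k (λ l → Q (z + suc l)) ≡ ∑ (suc (2 * k)) (λ j → Q (z + k ∸ j))
∑-window k Q z = begin
  ∑ (suc k) (λ l → Q (z ∸ l)) + ∑ k (λ l → Q (z + suc l))   ≡⟨ +-comm (∑ (suc k) (λ l → Q (z ∸ l))) _ ⟩
  ∑ k (λ l → Q (z + suc l)) + ∑ (suc k) (λ l → Q (z ∸ l))   ≡⟨ cong₂ _+_ upper lower ⟩
  ∑ k f + ∑ (suc k) (λ j → f (k + j))                        ≡⟨ ∑-split k (suc k) f ⟨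
  ∑ (k + suc k) f                                            ≡⟨ cong (λ L → ∑ L f) width ⟩
  ∑ (suc (2 * k)) f                                          ∎
  where
  open ≡-Reasoning
  f : ℕ → ℕ
  f j = Q (z + k ∸ j)
  upper : ∑ k (λ l → Q (z + suc l)) ≡ ∑ k f
  upper = sym (trans (∑-reverse k f) (∑-cong k (λ l l<k → cong Q (begin
    z + k ∸ (k ∸ suc l)                     ≡⟨ cong (λ x → z + x ∸ (k ∸ suc l)) (m+[n∸m]≡n l<k) ⟨
    z + (suc l + (k ∸ suc l)) ∸ (k ∸ suc l) ≡⟨ cong (_∸ (k ∸ suc l)) (+-assoc z (suc l) _) ⟨
    z + suc l + (k ∸ suc l) ∸ (k ∸ suc l)   ≡⟨ m+n∸n≡m (z + suc l) (k ∸ suc l) ⟩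
    z + suc l                               ∎))))
  lower : ∑ (suc k) (λ l → Q (z ∸ l)) ≡ ∑ (suc k) (λ j → f (k + j))
  lower = ∑-cong (suc k) (λ j _ → cong Q (sym (trans (sym (∸-+-assoc (z + k) k j)) (cong (_∸ j) (m+n∸n≡m z k)))))
  width : k + suc k ≡ suc (2 * k)
  width = trans (+-suc k k) (cong (λ x → suc (k + x)) (sym (+-identityʳ k)))

-- Kronecker delta, written exactly as in the definitions of identity and firstRow.
δ : ℕ → ℕ → ℕ
δ a b = if a ≡ᵇ b then 1 else 0

δ-refl : ∀ a → δ a a ≡ 1
δ-refl zero    = refl
δ-refl (suc a) = δ-refl a

δ-≢ : ∀ a b → a ≢ b → δ a b ≡ 0
δ-≢ zero    zero    a≢b = ⊥-elim (a≢b refl)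
δ-≢ zero    (suc b) a≢b = refl
δ-≢ (suc a) zero    a≢b = refl
δ-≢ (suc a) (suc b) a≢b = δ-≢ a b (a≢b ∘ cong suc)

∑-sift : ∀ L a (φ : ℕ → ℕ) → a < L → ∑ L (λ u → δ u a * φ u) ≡ φ a
∑-sift (suc L) zero    φ _ = trans (cong₂ _+_ (+-identityʳ (φ 0)) (∑-zero L (λ _ _ → refl))) (+-identityʳ (φ 0))
∑-sift (suc L) (suc a) φ (s<s a<L) = ∑-sift L a (φ ∘ suc) a<L

∑-indicator : ∀ L K (g φ : ℕ → ℕ) → (∀ l → l < K → g l < L) →
              ∑ L (λ u → ∑ K (λ l → δ u (g l)) * φ u) ≡ ∑ K (λ l → φ (g l))
∑-indicator L K g φ g<L = begin
  ∑ L (λ u → ∑ K (λ l → δ u (g l)) * φ u)   ≡⟨ ∑-cong L (λ u _ → ∑-*ʳ K (λ l → δ u (g l)) (φ u)) ⟩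
  ∑ L (λ u → ∑ K (λ l → δ u (g l) * φ u))   ≡⟨ ∑-comm L K (λ u l → δ u (g l) * φ u) ⟩
  ∑ K (λ l → ∑ L (λ u → δ u (g l) * φ u))   ≡⟨ ∑-cong K (λ l l<K → ∑-sift L (g l) φ (g<L l l<K)) ⟩
  ∑ K (λ l → φ (g l))                       ∎
  where open ≡-Reasoning

coeff-+ₚ : ∀ p q t → coeff (p +ₚ q) t ≡ coeff p t + coeff q t
coeff-+ₚ []      q       t       = refl
coeff-+ₚ (a ∷ p) []      t       = sym (+-identityʳ _)
coeff-+ₚ (a ∷ p) (b ∷ q) zero    = refl
coeff-+ₚ (a ∷ p) (b ∷ q) (suc t) = coeff-+ₚ p q t

coeff-scale : ∀ a q t → coeff (scale a q) t ≡ a * coeff q t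
coeff-scale a []      t       = sym (*-zeroʳ a)
coeff-scale a (b ∷ q) zero    = refl
coeff-scale a (b ∷ q) (suc t) = coeff-scale a q t

coeff-replicate : ∀ L a j → j < L → coeff (replicate L a) j ≡ a
coeff-replicate (suc L) a zero    _          = refl
coeff-replicate (suc L) a (suc j) (s<s j<L) = coeff-replicate L a j j<L

-- shiftedCoeff q t j is the coefficient of x^t in x^j · q.
shiftedCoeff : Poly → ℕ → ℕ → ℕ
shiftedCoeff q t       zero    = coeff q t
shiftedCoeff q zero    (suc j) = 0
shiftedCoeff q (suc t) (suc j) = shiftedCoeff q t j

shiftedCoeff-≤ : ∀ q {t j} → j ≤ t → shiftedCoeff q t j ≡ coeff q (t ∸ j)
shiftedCoeff-≤ q {t}     {zero}  _         = refl
shiftedCoeff-≤ q {suc t} {suc j} (s≤s j≤t) = shiftedCoeff-≤ q j≤t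

shiftedCoeff-> : ∀ q {t j} → t < j → shiftedCoeff q t j ≡ 0
shiftedCoeff-> q {zero}  {suc j} _         = refl
shiftedCoeff-> q {suc t} {suc j} (s<s t<j) = shiftedCoeff-> q t<j

coeff-*ₚ : ∀ p q t → coeff (p *ₚ q) t ≡ ∑ (length p) (λ j → coeff p j * shiftedCoeff q t j)
coeff-*ₚ []      q t       = refl
coeff-*ₚ (a ∷ p) q zero    =
  trans (coeff-+ₚ (scale a q) (0 ∷ (p *ₚ q)) zero)
        (cong₂ _+_ (coeff-scale a q zero) (sym (∑-zero (length p) (λ j _ → *-zeroʳ (coeff p j)))))
coeff-*ₚ (a ∷ p) q (suc t) =
  trans (coeff-+ₚ (scale a q) (0 ∷ (p *ₚ q)) (suc t))
        (cong₂ _+_ (coeff-scale a q (suc t)) (coeff-*ₚ p q t))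

coeff-geomPoly-*ₚ : ∀ k q t → coeff (geomPoly k *ₚ q) t ≡ ∑ (suc (2 * k)) (shiftedCoeff q t)
coeff-geomPoly-*ₚ k q t = begin
  coeff (geomPoly k *ₚ q) t                                           ≡⟨ coeff-*ₚ (geomPoly k) q t ⟩
  ∑ (length (geomPoly k)) (λ j → coeff (geomPoly k) j * shiftedCoeff q t j) ≡⟨ cong (λ L → ∑ L (λ j → coeff (geomPoly k) j * shiftedCoeff q t j)) (length-replicate (suc (2 * k))) ⟩
  ∑ (suc (2 * k)) (λ j → coeff (geomPoly k) j * shiftedCoeff q t j)   ≡⟨ ∑-cong (suc (2 * k)) one ⟩
  ∑ (suc (2 * k)) (shiftedCoeff q t)                                  ∎
  where
  open ≡-Reasoning
  one : ∀ j → j < suc (2 * k) → coeff (geomPoly k) j * shiftedCoeff q t j ≡ shiftedCoeff q t j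
  one j j<L = trans (cong (_* shiftedCoeff q t j) (coeff-replicate (suc (2 * k)) 1 j j<L))
                    (*-identityˡ _)

coeff-geomPow-deg : ∀ k m x → 2 * k * m < x → coeff (powₚ (geomPoly k) m) x ≡ 0
coeff-geomPow-deg k zero    (suc x) _ = refl
coeff-geomPow-deg k (suc m) x 2k[m+1]<x =
  trans (coeff-geomPoly-*ₚ k (powₚ (geomPoly k) m) x) (∑-zero (suc (2 * k)) vanishes)
  where
  vanishes : ∀ j → j < suc (2 * k) → shiftedCoeff (powₚ (geomPoly k) m) x j ≡ 0
  vanishes j j≤2k with j ≤? x
  ... | no j≰x = shiftedCoeff-> _ (≰⇒> j≰x)
  ... | yes j≤x = trans (shiftedCoeff-≤ _ j≤x) (coeff-geomPow-deg k m (x ∸ j) (m+n≤o⇒m≤o∸n (suc (2 * k * m)) (begin-strict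
      2 * k * m + j     ≤⟨ +-monoʳ-≤ (2 * k * m) (s≤s⁻¹ j≤2k) ⟩
      2 * k * m + 2 * k ≡⟨ +-comm (2 * k * m) (2 * k) ⟩
      2 * k + 2 * k * m ≡⟨ *-suc (2 * k) m ⟨
      2 * k * suc m     <⟨ 2k[m+1]<x ⟩
      x                 ∎)))
    where open ≤-Reasoning

module Cyclic (M : ℕ) where

  N : ℕ
  N = suc M

  %-absorbˡ : ∀ a b → (a % N + b) % N ≡ (a + b) % N
  %-absorbˡ a b = begin
    (a % N + b) % N           ≡⟨ %-distribˡ-+ (a % N) b N ⟩
    (a % N % N + b % N) % N   ≡⟨ cong (λ x → (x + b % N) % N) (m%n%n≡m%n a N) ⟩
    (a % N + b % N) % N       ≡⟨ %-distribˡ-+ a b N ⟨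
    (a + b) % N               ∎
    where open ≡-Reasoning

  %-absorbʳ : ∀ a b → (a + b % N) % N ≡ (a + b) % N
  %-absorbʳ a b = trans (cong (_% N) (+-comm a (b % N)))
                        (trans (%-absorbˡ b a) (cong (_% N) (+-comm b a)))

  -- Adding i is invertible modulo N (undo it by adding i · M).
  %-+-cancelʳ : ∀ i x y → (x + i) % N ≡ (y + i) % N → x % N ≡ y % N
  %-+-cancelʳ i x y eq = begin
    x % N                     ≡⟨ undo x ⟨
    (x + i + i * M) % N       ≡⟨ %-absorbˡ (x + i) (i * M) ⟨
    ((x + i) % N + i * M) % N ≡⟨ cong (λ z → (z + i * M) % N) eq ⟩
    ((y + i) % N + i * M) % N ≡⟨ %-absorbˡ (y + i) (i * M) ⟩
    (y + i + i * M) % N       ≡⟨ undo y ⟩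
    y % N                     ∎
    where
    open ≡-Reasoning
    undo : ∀ z → (z + i + i * M) % N ≡ z % N
    undo z = trans (cong (_% N) (trans (+-assoc z i (i * M)) (cong (z +_) (sym (*-suc i M)))))
                   ([m+kn]%n≡m%n z i N)

  -- x ⊖ y is the residue of x − y modulo N (for y ≤ N).  It is the index
  -- used by circ: circ N c i j reduces to c (toℕ j ⊖ toℕ i).
  infixl 6 _⊖_
  _⊖_ : ℕ → ℕ → ℕ
  x ⊖ y = (x + N ∸ y) % N

  ⊖<N : ∀ x y → x ⊖ y < N
  ⊖<N x y = m%n<n (x + N ∸ y) N

  ⊖-self : ∀ x → x ⊖ x ≡ 0
  ⊖-self x = trans (cong (_% N) (m+n∸m≡n x N)) (n%n≡0 N)

  ⊖-+ : ∀ x {y} → y ≤ N → (x ⊖ y + y) % N ≡ x % N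
  ⊖-+ x {y} y≤N = begin
    ((x + N ∸ y) % N + y) % N ≡⟨ %-absorbˡ (x + N ∸ y) y ⟩
    (x + N ∸ y + y) % N       ≡⟨ cong (_% N) (m∸n+n≡m (≤-trans y≤N (m≤n+m N x))) ⟩
    (x + N) % N               ≡⟨ [m+n]%n≡m%n x N ⟩
    x % N                     ∎
    where open ≡-Reasoning

  ⊖-unique : ∀ {a x y} → a < N → y ≤ N → (a + y) % N ≡ x % N → x ⊖ y ≡ a
  ⊖-unique {a} {x} {y} a<N y≤N eq = begin
    x ⊖ y        ≡⟨ m%n%n≡m%n (x + N ∸ y) N ⟨
    (x ⊖ y) % N  ≡⟨ %-+-cancelʳ y (x ⊖ y) a (trans (⊖-+ x y≤N) (sym eq)) ⟩
    a % N        ≡⟨ m<n⇒m%n≡m a<N ⟩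
    a            ∎
    where open ≡-Reasoning

  %-∸-cong : ∀ {x y j} → j ≤ x → j ≤ y → x % N ≡ y % N → (x ∸ j) % N ≡ (y ∸ j) % N
  %-∸-cong {x} {y} {j} j≤x j≤y eq = %-+-cancelʳ j (x ∸ j) (y ∸ j)
    (trans (cong (_% N) (m∸n+n≡m j≤x)) (trans eq (cong (_% N) (sym (m∸n+n≡m j≤y)))))

  ∑-rotate-one : ∀ (h : ℕ → ℕ) → (∀ x → h (x + N) ≡ h x) → ∑ N (h ∘ suc) ≡ ∑ N h
  ∑-rotate-one h periodic = begin
    ∑ N (h ∘ suc)              ≡⟨ ∑-last M (h ∘ suc) ⟩
    ∑ M (h ∘ suc) + h N        ≡⟨ cong (∑ M (h ∘ suc) +_) (periodic 0) ⟩
    ∑ M (h ∘ suc) + h 0        ≡⟨ +-comm _ (h 0) ⟩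
    ∑ N h                      ∎
    where open ≡-Reasoning

  ∑-rotate : ∀ a (h : ℕ → ℕ) → (∀ x → h (x + N) ≡ h x) → ∑ N (λ u → h (u + a)) ≡ ∑ N h
  ∑-rotate zero    h periodic = ∑-cong N (λ u _ → cong h (+-identityʳ u))
  ∑-rotate (suc a) h periodic = begin
    ∑ N (λ u → h (u + suc a))  ≡⟨ ∑-cong N (λ u _ → cong h (+-suc u a)) ⟩
    ∑ N (λ u → h (suc (u + a))) ≡⟨ ∑-rotate a (h ∘ suc) (periodic ∘ suc) ⟩
    ∑ N (h ∘ suc)              ≡⟨ ∑-rotate-one h periodic ⟩
    ∑ N h                      ∎
    where open ≡-Reasoning

  toFin : ℕ → Fin N
  toFin x = fromℕ< (m%n<n x N)

  toℕ-toFin : ∀ x → toℕ (toFin x) ≡ x % N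
  toℕ-toFin x = toℕ-fromℕ< (m%n<n x N)

  toFin-toℕ : ∀ (i : Fin N) → toFin (toℕ i) ≡ i
  toFin-toℕ i = toℕ-injective (trans (toℕ-toFin (toℕ i)) (m<n⇒m%n≡m (toℕ<n i)))

  toFin-+N : ∀ x → toFin (x + N) ≡ toFin x
  toFin-+N x = toℕ-injective (trans (toℕ-toFin (x + N)) (trans ([m+n]%n≡m%n x N) (sym (toℕ-toFin x))))

  sumFin-rotate : ∀ a (F : Fin N → ℕ) → sumFin F ≡ ∑ N (λ u → F (toFin (u + a)))
  sumFin-rotate a F = begin
    sumFin F                         ≡⟨ sumFin-cong (λ i → cong F (sym (toFin-toℕ i))) ⟩
    ∑ N (F ∘ toFin)                  ≡⟨ ∑-rotate a (F ∘ toFin) (λ x → cong F (toFin-+N x)) ⟨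
    ∑ N (λ u → F (toFin (u + a)))    ∎
    where open ≡-Reasoning

  _⊛_ : (ℕ → ℕ) → (ℕ → ℕ) → (ℕ → ℕ)
  (c ⊛ g) r = ∑ N (λ u → c u * g (r ⊖ u))

  circ-⊗ : ∀ c g (i j : Fin N) → (circ N c ⊗ circ N g) i j ≡ circ N (c ⊛ g) i j
  circ-⊗ c g i j = begin
    sumFin {N} (λ l → c (toℕ l ⊖ a) * g (b ⊖ toℕ l))
      ≡⟨ sumFin-rotate a (λ l → c (toℕ l ⊖ a) * g (b ⊖ toℕ l)) ⟩
    ∑ N (λ u → c (toℕ (toFin (u + a)) ⊖ a) * g (b ⊖ toℕ (toFin (u + a))))
      ≡⟨ ∑-cong N term ⟩
    ∑ N (λ u → c u * g ((b ⊖ a) ⊖ u))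
      ∎
    where
    open ≡-Reasoning
    a b : ℕ
    a = toℕ i
    b = toℕ j
    a≤N : a ≤ N
    a≤N = <⇒≤ (toℕ<n i)
    first : ∀ u → u < N → (u + a) % N ⊖ a ≡ u
    first u u<N = ⊖-unique u<N a≤N (sym (m%n%n≡m%n (u + a) N))
    second : ∀ u → u < N → b ⊖ (u + a) % N ≡ (b ⊖ a) ⊖ u
    second u u<N = ⊖-unique (⊖<N (b ⊖ a) u) (m%n≤n (u + a) N) (begin
      (d + (u + a) % N) % N   ≡⟨ %-absorbʳ d (u + a) ⟩
      (d + (u + a)) % N       ≡⟨ cong (_% N) (+-assoc d u a) ⟨
      (d + u + a) % N         ≡⟨ %-absorbˡ (d + u) a ⟨
      ((d + u) % N + a) % N   ≡⟨ cong (λ x → (x + a) % N) (⊖-+ (b ⊖ a) (<⇒≤ u<N)) ⟩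
      ((b ⊖ a) % N + a) % N   ≡⟨ %-absorbˡ (b ⊖ a) a ⟩
      (b ⊖ a + a) % N         ≡⟨ ⊖-+ b a≤N ⟩
      b % N                   ∎)
      where
      d : ℕ
      d = (b ⊖ a) ⊖ u
    term : ∀ u → u < N → c (toℕ (toFin (u + a)) ⊖ a) * g (b ⊖ toℕ (toFin (u + a)))
                        ≡ c u * g ((b ⊖ a) ⊖ u)
    term u u<N rewrite toℕ-toFin (u + a) = cong₂ _*_ (cong c (first u u<N)) (cong g (second u u<N))

  identity-circ : ∀ (i j : Fin N) → identity i j ≡ circ N (λ r → δ r 0) i j
  identity-circ i j with toℕ i ≟ toℕ j
  ... | yes i≡j = trans (trans (cong (δ (toℕ i)) (sym i≡j)) (δ-refl (toℕ i)))
                        (cong (λ x → δ x 0) (sym (trans (cong (_⊖ toℕ i) (sym i≡j)) (⊖-self (toℕ i)))))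
  ... | no i≢j = trans (δ-≢ (toℕ i) (toℕ j) i≢j) (sym (δ-≢ (toℕ j ⊖ toℕ i) 0 j⊖i≢0))
    where
    j⊖i≢0 : toℕ j ⊖ toℕ i ≢ 0
    j⊖i≢0 eq = i≢j (begin
      toℕ i                         ≡⟨ m<n⇒m%n≡m (toℕ<n i) ⟨
      toℕ i % N                     ≡⟨ cong (λ x → (x + toℕ i) % N) eq ⟨
      (toℕ j ⊖ toℕ i + toℕ i) % N   ≡⟨ ⊖-+ (toℕ j) (<⇒≤ (toℕ<n i)) ⟩
      toℕ j % N                     ≡⟨ m<n⇒m%n≡m (toℕ<n j) ⟩
      toℕ j                         ∎)
      where open ≡-Reasoning

  rowPow : (ℕ → ℕ) → ℕ → (ℕ → ℕ)
  rowPow c zero    = λ r → δ r 0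
  rowPow c (suc m) = c ⊛ rowPow c m

  matPow-circ : ∀ c m (i j : Fin N) → matPow (circ N c) m i j ≡ circ N (rowPow c m) i j
  matPow-circ c zero    i j = identity-circ i j
  matPow-circ c (suc m) i j =
    trans (sumFin-cong (λ l → cong (circ N c i l *_) (matPow-circ c m l j)))
          (circ-⊗ c (rowPow c m) i j)

  trace-circ : ∀ g → trace (circ N g) ≡ N * g 0
  trace-circ g = trans (sumFin-cong {N} (λ i → cong g (⊖-self (toℕ i)))) (∑-const N (g 0))

-- Walks on Z/N with steps in {-k, …, k}.  Their number, for m steps
-- ending at r, is a coefficient of (1 + x + ⋯ + x^{2k})^m read modulo N;
-- as long as 2km ≤ M nothing wraps around.
module Walks (k M : ℕ) where
  open Cyclic M

  P : ℕ → Poly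
  P m = powₚ (geomPoly k) m

  wrapped : ℕ → ℕ → ℕ
  wrapped m x = coeff (P m) (x % N)

  -- the number of walks of length m from 0 to r, as given by the generating function
  walks : ℕ → ℕ → ℕ
  walks m r = wrapped m (r + k * m)

  wrapped-+N : ∀ m x → wrapped m (x + N) ≡ wrapped m x
  wrapped-+N m x = cong (coeff (P m)) ([m+n]%n≡m%n x N)

  wrapped-absorb : ∀ m x y → wrapped m (x % N + y) ≡ wrapped m (x + y)
  wrapped-absorb m x y = cong (coeff (P m)) (%-absorbˡ x y)

  2k≤M : ∀ m → 2 * k * suc m ≤ M → 2 * k ≤ M
  2k≤M m bound = ≤-trans (m≤m*n (2 * k) (suc m)) bound

  wrapped-step : ∀ m → 2 * k * suc m ≤ M → ∀ w → 2 * k ≤ w →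
                 ∑ (suc (2 * k)) (λ j → wrapped m (w ∸ j)) ≡ wrapped (suc m) w
  wrapped-step m bound w 2k≤w =
    sym (trans (coeff-geomPoly-*ₚ k (P m) t) (∑-cong (suc (2 * k)) term))
    where
    t : ℕ
    t = w % N
    term : ∀ j → j < suc (2 * k) → shiftedCoeff (P m) t j ≡ wrapped m (w ∸ j)
    term j j≤2k with j ≤? t
    ... | yes j≤t = trans (shiftedCoeff-≤ (P m) j≤t) (cong (coeff (P m)) (sym (begin
      (w ∸ j) % N  ≡⟨ %-∸-cong (≤-trans (s≤s⁻¹ j≤2k) 2k≤w) j≤t (sym (m%n%n≡m%n w N)) ⟩
      (t ∸ j) % N  ≡⟨ m<n⇒m%n≡m (≤-<-trans (m∸n≤m t j) (m%n<n w N)) ⟩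
      t ∸ j        ∎)))
      where open ≡-Reasoning
    ... | no j≰t = trans (shiftedCoeff-> (P m) t<j) (sym (trans (cong (coeff (P m)) wraps)
                     (coeff-geomPow-deg k m (t + N ∸ j) (m+n≤o⇒m≤o∸n (suc (2 * k * m)) beyond))))
      where
      open ≤-Reasoning
      t<j : t < j
      t<j = ≰⇒> j≰t
      beyond : suc (2 * k * m) + j ≤ t + N
      beyond = begin
        suc (2 * k * m + j)     ≤⟨ s≤s (+-monoʳ-≤ (2 * k * m) (s≤s⁻¹ j≤2k)) ⟩
        suc (2 * k * m + 2 * k) ≡⟨ cong suc (trans (+-comm (2 * k * m) (2 * k)) (sym (*-suc (2 * k) m))) ⟩
        suc (2 * k * suc m)     ≤⟨ s≤s bound ⟩
        N                       ≤⟨ m≤n+m N t ⟩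
        t + N                   ∎
      wraps : (w ∸ j) % N ≡ t + N ∸ j
      wraps = trans (%-∸-cong (≤-trans (s≤s⁻¹ j≤2k) 2k≤w) (m+n≤o⇒n≤o (suc (2 * k * m)) beyond)
                        (trans (sym (m%n%n≡m%n w N)) (sym ([m+n]%n≡m%n t N))))
                    (m<n⇒m%n≡m (m<n+o⇒m∸n<o (t + N) j (+-monoˡ-< N t<j)))

  -- c is the indicator of the steps {-k, …, k} modulo N = M + 1:
  -- summing against c picks out the residues 0, …, k and M, …, M ∸ (k ∸ 1).
  Sifts : (ℕ → ℕ) → Set
  Sifts c = ∀ φ → ∑ N (λ u → c u * φ u) ≡ ∑ (suc k) φ + ∑ k (λ l → φ (M ∸ l))

  walks-step : ∀ {c} → Sifts c → ∀ m → 2 * k * suc m ≤ M → ∀ r → (c ⊛ walks m) r ≡ walks (suc m) r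
  walks-step {c} sifts m bound r = begin
    ∑ N (λ u → c u * walks m (r ⊖ u))                                            ≡⟨ sifts (λ u → walks m (r ⊖ u)) ⟩
    ∑ (suc k) (λ l → walks m (r ⊖ l)) + ∑ k (λ l → walks m (r ⊖ (M ∸ l)))        ≡⟨ cong₂ _+_ (∑-cong (suc k) forward) (∑-cong k backward) ⟩
    ∑ (suc k) (λ l → wrapped m (z ∸ l)) + ∑ k (λ l → wrapped m (z + suc l))      ≡⟨ ∑-window k (wrapped m) z ⟩
    ∑ (suc (2 * k)) (λ j → wrapped m (z + k ∸ j))                                ≡⟨ wrapped-step m bound (z + k) 2k≤z+k ⟩
    wrapped (suc m) (z + k)                                                      ≡⟨ cong (wrapped (suc m)) (solve 4 (λ r n k m → r :+ n :+ k :* m :+ k := r :+ k :* (con 1 :+ m) :+ n) refl r N k m) ⟩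
    wrapped (suc m) (r + k * suc m + N)                                          ≡⟨ wrapped-+N (suc m) (r + k * suc m) ⟩
    walks (suc m) r                                                              ∎
    where
    open ≡-Reasoning
    -- centre of the window, shifted by N so that z ∸ l never truncates
    z : ℕ
    z = r + N + k * m
    k≤M : k ≤ M
    k≤M = ≤-trans (m≤m+n k (k + 0)) (2k≤M m bound)
    2k≤z+k : 2 * k ≤ z + k
    2k≤z+k = ≤-trans (2k≤M m bound) (≤-trans (n≤1+n M) (≤-trans (m≤n+m N r) (≤-trans (m≤m+n (r + N) (k * m)) (m≤m+n z k))))
    forward : ∀ l → l < suc k → walks m (r ⊖ l) ≡ wrapped m (z ∸ l)
    forward l l≤k = trans (wrapped-absorb m (r + N ∸ l) (k * m))
      (cong (wrapped m) (sym (+-∸-comm (k * m) (≤-trans (s≤s⁻¹ l≤k) (≤-trans k≤M (≤-trans (n≤1+n M) (m≤n+m N r)))))))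
    r+N∸[M∸l] : ∀ {l} → l ≤ M → r + N ∸ (M ∸ l) ≡ r + suc l
    r+N∸[M∸l] {l} l≤M = begin
      r + suc M ∸ (M ∸ l)                   ≡⟨ cong (λ x → r + suc x ∸ (M ∸ l)) (m+[n∸m]≡n l≤M) ⟨
      r + (suc l + (M ∸ l)) ∸ (M ∸ l)       ≡⟨ cong (_∸ (M ∸ l)) (+-assoc r (suc l) (M ∸ l)) ⟨
      r + suc l + (M ∸ l) ∸ (M ∸ l)         ≡⟨ m+n∸n≡m (r + suc l) (M ∸ l) ⟩
      r + suc l                             ∎
    backward : ∀ l → l < k → walks m (r ⊖ (M ∸ l)) ≡ wrapped m (z + suc l)
    backward l l<k = begin
      wrapped m ((r + N ∸ (M ∸ l)) % N + k * m) ≡⟨ wrapped-absorb m (r + N ∸ (M ∸ l)) (k * m) ⟩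
      wrapped m (r + N ∸ (M ∸ l) + k * m)       ≡⟨ cong (λ x → wrapped m (x + k * m)) (r+N∸[M∸l] (≤-trans (<⇒≤ l<k) k≤M)) ⟩
      wrapped m (r + suc l + k * m)             ≡⟨ wrapped-+N m (r + suc l + k * m) ⟨
      wrapped m (r + suc l + k * m + N)         ≡⟨ cong (wrapped m) (solve 4 (λ r n x s → r :+ s :+ x :+ n := r :+ n :+ x :+ s) refl r N (k * m) (suc l)) ⟩
      wrapped m (z + suc l)                     ∎

  rowPow-walks : ∀ {c} → Sifts c → ∀ m → 2 * k * m ≤ M → ∀ r → r < N → rowPow c m r ≡ walks m r
  rowPow-walks sifts zero    _     r r<N = sym (trans (cong (coeff (1 ∷ [])) r+0%N) (unit r))
    where
    r+0%N : (r + k * 0) % N ≡ r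
    r+0%N = trans (cong (λ x → (r + x) % N) (*-zeroʳ k)) (trans (cong (_% N) (+-identityʳ r)) (m<n⇒m%n≡m r<N))
    unit : ∀ r → coeff (1 ∷ []) r ≡ δ r 0
    unit zero    = refl
    unit (suc r) = refl
  rowPow-walks {c} sifts (suc m) bound r r<N =
    trans (∑-cong N (λ u _ → cong (c u *_) (rowPow-walks {c} sifts m (≤-trans (*-monoʳ-≤ (2 * k) (n≤1+n m)) bound) (r ⊖ u) (⊖<N r u))))
          (walks-step {c} sifts m bound r)

firstRow-sifts : ∀ k n → k ≤ 2 * k * n → Walks.Sifts k (2 * k * n) (firstRow k n)
firstRow-sifts k n k≤M φ = begin
  ∑ N (λ u → firstRow k n u * φ u)
    ≡⟨ ∑-cong N (λ u _ → *-distribʳ-+ (φ u) (∑ (suc k) (δ u)) (∑ k (λ l → δ u (M ∸ l)))) ⟩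
  ∑ N (λ u → ∑ (suc k) (δ u) * φ u + ∑ k (λ l → δ u (M ∸ l)) * φ u)
    ≡⟨ ∑-+ N (λ u → ∑ (suc k) (δ u) * φ u) (λ u → ∑ k (λ l → δ u (M ∸ l)) * φ u) ⟩
  ∑ N (λ u → ∑ (suc k) (δ u) * φ u) + ∑ N (λ u → ∑ k (λ l → δ u (M ∸ l)) * φ u)
    ≡⟨ cong₂ _+_ (∑-indicator N (suc k) (λ l → l) φ (λ l l≤k → s≤s (≤-trans (s≤s⁻¹ l≤k) k≤M)))
                 (∑-indicator N k (M ∸_) φ (λ l _ → s≤s (m∸n≤m M l))) ⟩
  ∑ (suc k) φ + ∑ k (λ l → φ (M ∸ l))  ∎
  where
  open ≡-Reasoning
  M N : ℕ
  M = 2 * k * n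
  N = suc M

lemma1 : (k n : ℕ) → k ≥ 1 → n ≥ 1 →
    (2 * k * n + 1) * centralMultinomial k n ≡ trace (matPow (Cmat k n) n)
lemma1 k n _ n≥1 = begin
  (M + 1) * centralMultinomial k n    ≡⟨ cong₂ _*_ (+-comm M 1) (cong (coeff (P n)) (sym kn%N)) ⟩
  N * walks n 0                       ≡⟨ cong (N *_) (rowPow-walks sifts n ≤-refl 0 z<s) ⟨
  N * rowPow c n 0                    ≡⟨ trace-circ (rowPow c n) ⟨
  trace (circ N (rowPow c n))         ≡⟨ sumFin-cong (λ i → matPow-circ c n i i) ⟨
  trace (matPow (Cmat k n) n)         ∎
  where
  open ≡-Reasoning
  M : ℕ
  M = 2 * k * n
  c : ℕ → ℕ
  c = firstRow k n
  open Cyclic M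
  open Walks k M
  kn%N : (k * n) % N ≡ k * n
  kn%N = m<n⇒m%n≡m (s≤s (*-monoˡ-≤ n (m≤m+n k (k + 0))))
  -- n ≥ 1 ensures that the steps 0, …, k are residues modulo N
  k≤M : k ≤ M
  k≤M = ≤-trans (m≤m+n k (k + 0)) (≤-trans (≤-reflexive (sym (*-identityʳ (2 * k)))) (*-monoʳ-≤ (2 * k) n≥1))
  sifts : Sifts c
  sifts = firstRow-sifts k n k≤M
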